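{- Let $\Gamma$ be a Neumaier graph on $v$ vertices with valency $k$ and parameter $\lambda$, and let $s,e$ be as defined in the context. Suppose every clique of $\Gamma$ of order $e+1$ is contained in a clique of order $s+1$. Then $\Gamma$ has diameter $2$.
   Context: A graph is edge-regular if it is regular and any two adjacent vertices have the same number $\lambda$ of common neighbours. A clique $C$ in a regular graph is a regular clique if every vertex outside $C$ is adjacent to the same positive number of vertices of $C$. A Neumaier graph is a non-complete edge-regular graph containing a regular clique. For a non-complete edge-regular graph $\Gamma$ on $v$ vertices with valency $k\ge 1$ and parameter $\lambda$: if $\Gamma$ is a complete multipartite graph, $s+1$ denotes its number of parts; otherwise $$s:=\frac{ -(k^2-k+\lambda-v\lambda)+\sqrt{(k^2-k+\lambda-v\lambda)^2+4k(v-k-1)(v+\lambda-2k)}}{2(v+\lambda-2k)}.$$ Further $e:=\frac{(s+1)(k-s)}{v-(s+1)}$. -}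

module Defs where

open import Data.Nat using (ℕ; suc; _≥_)
open import Data.Integer as ℤ using (ℤ; +_; 0ℤ; _-_; _*_; _+_)
open import Data.Bool using (Bool; true; false)
open import Data.Fin using (Fin)
open import Data.Fin.Subset using (Subset; _∈_; _∉_; _⊆_; _∩_; ∣_∣)
open import Data.Vec using (tabulate)
open import Data.Product using (Σ; ∃; ∃-syntax; _×_)
open import Data.Sum using (_⊎_)
open import Function.Definitions using (Surjective)
open import Relation.Binary.PropositionalEquality using (_≡_; _≢_)
open import Relation.Nullary using (¬_)

record Graph (v : ℕ) : Set where
  field
    adj   : Fin v → Fin v → Bool
    sym   : ∀ x y → adj x y ≡ adj y x
    irrefl : ∀ x → adj x x ≡ false

module _ {v : ℕ} (Γ : Graph v) where
  open Graph Γ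

  _~_ : Fin v → Fin v → Set
  x ~ y = adj x y ≡ true

  N : Fin v → Subset v
  N x = tabulate (adj x)

  IsRegular : ℕ → Set
  IsRegular k = ∀ x → ∣ N x ∣ ≡ k

  IsEdgeRegular : ℕ → ℕ → Set
  IsEdgeRegular k λ' = IsRegular k × (∀ x y → x ~ y → ∣ N x ∩ N y ∣ ≡ λ')

  IsComplete : Set
  IsComplete = ∀ x y → x ≢ y → x ~ y

  IsClique : Subset v → Set
  IsClique C = ∀ x y → x ∈ C → y ∈ C → x ≢ y → x ~ y

  IsRegularClique : Subset v → Set
  IsRegularClique C = IsClique C × Σ ℕ (λ m → m ≥ 1 × (∀ x → x ∉ C → ∣ N x ∩ C ∣ ≡ m))

  IsNeumaier : ℕ → ℕ → Set
  IsNeumaier k λ' = ¬ IsComplete × IsEdgeRegular k λ' × ∃[ C ] IsRegularClique C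

  IsCompleteMultipartiteWithParts : ℕ → Set
  IsCompleteMultipartiteWithParts p =
    Σ (Fin v → Fin p) (λ f → Surjective _≡_ _≡_ f × (∀ x y → (x ~ y → f x ≢ f y) × (f x ≢ f y → x ~ y)))

  IsCompleteMultipartite : Set
  IsCompleteMultipartite = ∃[ p ] IsCompleteMultipartiteWithParts p

  HasDiameter2 : Set
  HasDiameter2 =
    (∀ x y → x ≡ y ⊎ x ~ y ⊎ ∃[ z ] (x ~ z × z ~ y))
    × ∃[ x ] ∃[ y ] (x ≢ y × ¬ x ~ y)

  -- Non-multipartite case: with B = k²-k+λ-vλ, D = v+λ-2k, C = k(v-k-1), the formula
  -- s = (-B + √(B² + 4CD)) / (2D) holds iff D ≠ 0 (here D > 0), 2DS + B ≥ 0 and (2DS + B)² = B² + 4CD.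
  IsParamS : ℕ → ℕ → ℕ → Set
  IsParamS k λ' S =
    IsCompleteMultipartiteWithParts (suc S)
    ⊎ (¬ IsCompleteMultipartite
       × ℤ.0ℤ ℤ.< D
       × 0ℤ ℤ.≤ T
       × T * T ≡ (B * B) + ((+ 4) * Cc * D))
    where
      B D Cc T : ℤ
      B = (+ k) * (+ k) - (+ k) + (+ λ') - (+ v) * (+ λ')
      D = (+ v) + (+ λ') - (+ 2) * (+ k)
      Cc = (+ k) * ((+ v) - (+ k) - (+ 1))
      T = (+ 2) * D * (+ S) + B

  IsParamE : ℕ → ℕ → ℕ → Set
  IsParamE k S E =
    ((+ v) - (+ suc S) ≢ 0ℤ) × ((+ E) * ((+ v) - (+ suc S)) ≡ (+ suc S) * ((+ k) - (+ S)))

-- For a clique K of order c in an edge-regular graph, let a(u) be the number of neighbours in K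
-- of a vertex u outside K. Counting pairs gives Σ a = c(k-c+1) and
-- Σ a² = c(k-c+1) + c(c-1)(λ-c+2) over the v-c outside vertices, and then
-- (v-c)·Σ a² - (Σ a)² = -c·q(c-1), where q is the quadratic whose root is s. If K is regular,
-- a is constant, so q(c-1) = 0, hence c = s+1 (q has a single nonnegative root), and the nexus
-- is e. If c = s+1, the variance of a vanishes, so every outside vertex has exactly e neighbours
-- in K. Now let x, y be at distance at least 3 and C the regular clique. Then x ∉ C, and x
-- together with its e neighbours in C is a clique of order e+1; it lies in a clique D of order
-- s+1, y ∉ D, and any of the e ≥ 1 neighbours of y in D is a common neighbour of x and y. In the
-- complete multipartite case two non-adjacent vertices lie in the same part and so have the same
-- neighbours.
module Submission where

open import Defs hiding (_~_)
import Defs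

open import Data.Nat using (ℕ; zero; suc)
import Data.Nat as ℕ
import Data.Nat.Properties as ℕ
open import Data.Bool as Bool using (Bool; true; false; _∧_)
open import Data.Fin using (Fin; zero; suc; _≟_)
open import Data.Fin.Properties using (any?; all?; ¬∀⟶∃¬)
open import Data.Fin.Subset using (Subset; ∣_∣; _⊆_; _∈_; _∉_; _∩_; _∪_; ⁅_⁆; Nonempty)
open import Data.Fin.Subset.Properties
  using (_∈?_; ∪-identityˡ; drop-not-there; x∈p∩q⁻; x∈p∪q⁻; x∈p∪q⁺; x∈⁅x⁆; x∈⁅y⁆⇒x≡y;
         ∣p∣≤n; ∣p∩q∣≤∣p∣; ∣p∩q∣≤∣q∣)
open import Data.Integer
  using (ℤ; +_; -[1+_]; 0ℤ; 1ℤ; _-_; _*_; _+_; -_; _≤_; _<_; +≤+; NonZero; >-nonZero; ≢-nonZero)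
import Data.Integer.Properties as ℤ
open import Data.Integer.Tactic.RingSolver using (solve-∀)
open import Algebra.Properties.Semiring.Sum ℤ.+-*-semiring
  using (sum; sum-syntax; ∑-distrib-+; ∑-comm; sum-cong-≗; sum-replicate-zero; *-distribˡ-sum; *-distribʳ-sum)
open import Data.Vec using ([]; _∷_; here; there; lookup)
open import Data.Vec.Properties using ([]=⇒lookup; lookup⇒[]=; lookup-zipWith; lookup∘tabulate)
open import Data.Product using (Σ; _×_; _,_; proj₁; proj₂; map; map₁; ∃-syntax)
open import Data.Sum using (_⊎_; inj₁; inj₂; [_,_]′; reduce)
open import Data.Empty using (⊥)
open import Function using (_∘_; flip)
open import Relation.Binary.PropositionalEquality
open import Relation.Nullary using (¬_; Dec; does; yes; no; contradiction)
open import Relation.Nullary.Decidable using (decidable-stable; ¬?; _×-dec_; _→-dec_)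

0≤i*j : ∀ {i j} → 0ℤ ≤ i → 0ℤ ≤ j → 0ℤ ≤ i * j
0≤i*j {+ m} {+ n} _ _ = subst (0ℤ ≤_) (ℤ.pos-* m n) (+≤+ ℕ.z≤n)

0≤i*i : ∀ i → 0ℤ ≤ i * i
0≤i*i (+ n)      = subst (0ℤ ≤_) (ℤ.pos-* n n) (+≤+ ℕ.z≤n)
0≤i*i -[1+ n ]   = +≤+ ℕ.z≤n

1≤i*j : ∀ {i j} → 1ℤ ≤ i → 1ℤ ≤ j → 1ℤ ≤ i * j
1≤i*j (+≤+ (ℕ.s≤s _)) (+≤+ (ℕ.s≤s _)) = +≤+ (ℕ.s≤s ℕ.z≤n)

i*i≡0⇒i≡0 : ∀ i → i * i ≡ 0ℤ → i ≡ 0ℤ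
i*i≡0⇒i≡0 i = reduce ∘ ℤ.i*j≡0⇒i≡0∨j≡0 i

i*j≡0⇒j≡0 : ∀ i {j} .{{_ : NonZero i}} → i * j ≡ 0ℤ → j ≡ 0ℤ
i*j≡0⇒j≡0 i {j} ij≡0 = ℤ.*-cancelˡ-≡ i j 0ℤ (trans ij≡0 (sym (ℤ.*-zeroʳ i)))

nonneg-+-≡0 : ∀ {i j} → 0ℤ ≤ i → 0ℤ ≤ j → i + j ≡ 0ℤ → i ≡ 0ℤ × j ≡ 0ℤ
nonneg-+-≡0 {+ m} {+ n} (+≤+ _) (+≤+ _) m+n≡0 =
  cong +_ (ℕ.m+n≡0⇒m≡0 m (ℤ.+-injective m+n≡0)) , cong +_ (ℕ.m+n≡0⇒n≡0 m (ℤ.+-injective m+n≡0))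

𝟙 : Bool → ℤ
𝟙 true  = 1ℤ
𝟙 false = 0ℤ

𝟙-∧ : ∀ a b → 𝟙 (a ∧ b) ≡ 𝟙 a * 𝟙 b
𝟙-∧ true  b = sym (ℤ.*-identityˡ (𝟙 b))
𝟙-∧ false b = refl

𝟙-idem : ∀ a → 𝟙 a * 𝟙 a ≡ 𝟙 a
𝟙-idem true  = refl
𝟙-idem false = refl

0≤1-𝟙 : ∀ a → 0ℤ ≤ 1ℤ - 𝟙 a
0≤1-𝟙 true  = +≤+ ℕ.z≤n
0≤1-𝟙 false = +≤+ ℕ.z≤n

∑-neg : ∀ {n} (f : Fin n → ℤ) → ∑[ i < n ] (- f i) ≡ - ∑[ i < n ] f i
∑-neg {zero}  f = refl
∑-neg {suc n} f = trans (cong (_+_ (- f zero)) (∑-neg (f ∘ suc))) (sym (ℤ.neg-distrib-+ (f zero) _))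

∑-distrib-- : ∀ {n} (f g : Fin n → ℤ) → ∑[ i < n ] (f i - g i) ≡ ∑[ i < n ] f i - ∑[ i < n ] g i
∑-distrib-- f g = trans (∑-distrib-+ f (λ i → - g i)) (cong (_+_ (sum f)) (∑-neg g))

∑-1 : ∀ n → ∑[ i < n ] 1ℤ ≡ + n
∑-1 zero    = refl
∑-1 (suc n) = trans (cong (_+_ 1ℤ) (∑-1 n)) (sym (ℤ.pos-+ 1 n))

∑-*-∑ : ∀ {m n} (f : Fin m → ℤ) (g : Fin n → ℤ) →
        ∑[ i < m ] f i * ∑[ j < n ] g j ≡ ∑[ i < m ] ∑[ j < n ] (f i * g j)
∑-*-∑ f g = trans (*-distribʳ-sum (sum g) f) (sum-cong-≗ (λ i → *-distribˡ-sum (f i) g))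

∑-complement : ∀ {n} (w g : Fin n → ℤ) →
               ∑[ i < n ] ((1ℤ - w i) * g i) ≡ ∑[ i < n ] g i - ∑[ i < n ] (w i * g i)
∑-complement w g = trans (sum-cong-≗ (λ i → distrib (w i) (g i))) (∑-distrib-- g (λ i → w i * g i))
  where
  distrib : ∀ w g → (1ℤ - w) * g ≡ g - w * g
  distrib = solve-∀

δ : ∀ {n} → Fin n → Fin n → ℤ
δ i j = 𝟙 (does (i ≟ j))

∑-δ : ∀ {n} (i : Fin n) (f : Fin n → ℤ) → ∑[ j < n ] (δ i j * f j) ≡ f i
∑-δ {suc n} zero    f = begin
  1ℤ * f zero + ∑[ j < n ] 0ℤ  ≡⟨ cong₂ _+_ (ℤ.*-identityˡ (f zero)) (sum-replicate-zero n) ⟩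
  f zero + 0ℤ                 ≡⟨ ℤ.+-identityʳ (f zero) ⟩
  f zero                      ∎
  where open ≡-Reasoning
∑-δ {suc n} (suc i) f = trans (ℤ.+-identityˡ _) (∑-δ i (f ∘ suc))

∑δ≡1 : ∀ {n} (i : Fin n) → ∑[ j < n ] δ i j ≡ 1ℤ
∑δ≡1 i = trans (sum-cong-≗ (λ j → sym (ℤ.*-identityʳ (δ i j)))) (∑-δ i (λ _ → 1ℤ))

∑-nonneg : ∀ {n} {f : Fin n → ℤ} → (∀ i → 0ℤ ≤ f i) → 0ℤ ≤ ∑[ i < n ] f i
∑-nonneg {zero}  _   = +≤+ ℕ.z≤n
∑-nonneg {suc n} f≥0 = ℤ.+-mono-≤ (f≥0 zero) (∑-nonneg (f≥0 ∘ suc))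

∑-nonneg-≡0 : ∀ {n} {f : Fin n → ℤ} → (∀ i → 0ℤ ≤ f i) → ∑[ i < n ] f i ≡ 0ℤ → ∀ i → f i ≡ 0ℤ
∑-nonneg-≡0 f≥0 ∑f≡0 zero    = proj₁ (nonneg-+-≡0 (f≥0 zero) (∑-nonneg (f≥0 ∘ suc)) ∑f≡0)
∑-nonneg-≡0 f≥0 ∑f≡0 (suc i) =
  ∑-nonneg-≡0 (f≥0 ∘ suc) (proj₂ (nonneg-+-≡0 (f≥0 zero) (∑-nonneg (f≥0 ∘ suc)) ∑f≡0)) i

∑-weighted-variance : ∀ {n} (w f : Fin n → ℤ) →
  let W  = ∑[ i < n ] w i
      S₁ = ∑[ i < n ] (w i * f i)
      S₂ = ∑[ i < n ] (w i * (f i * f i))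
  in ∑[ i < n ] (w i * ((W * f i - S₁) * (W * f i - S₁))) ≡ W * (W * S₂ - S₁ * S₁)
∑-weighted-variance {n} w f = begin
  ∑[ i < n ] (w i * ((W * f i - S₁) * (W * f i - S₁)))
    ≡⟨ sum-cong-≗ (λ i → expand (w i) (f i) W S₁) ⟩
  ∑[ i < n ] (W * W * (w i * (f i * f i)) + - (+ 2 * W * S₁) * (w i * f i) + S₁ * S₁ * w i)
    ≡⟨ trans (∑-distrib-+ (λ i → W * W * (w i * (f i * f i)) + - (+ 2 * W * S₁) * (w i * f i))
                          (λ i → S₁ * S₁ * w i))
             (cong (_+ ∑[ i < n ] (S₁ * S₁ * w i))
                   (∑-distrib-+ (λ i → W * W * (w i * (f i * f i))) (λ i → - (+ 2 * W * S₁) * (w i * f i)))) ⟩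
  ∑[ i < n ] (W * W * (w i * (f i * f i))) + ∑[ i < n ] (- (+ 2 * W * S₁) * (w i * f i))
    + ∑[ i < n ] (S₁ * S₁ * w i)
    ≡⟨ sym (cong₂ _+_ (cong₂ _+_ (*-distribˡ-sum (W * W) (λ i → w i * (f i * f i)))
                                        (*-distribˡ-sum (- (+ 2 * W * S₁)) (λ i → w i * f i)))
                      (*-distribˡ-sum (S₁ * S₁) w)) ⟩
  W * W * S₂ + - (+ 2 * W * S₁) * S₁ + S₁ * S₁ * W
    ≡⟨ collect W S₁ S₂ ⟩
  W * (W * S₂ - S₁ * S₁) ∎
  where
  open ≡-Reasoning
  W S₁ S₂ : ℤ
  W  = ∑[ i < n ] w i
  S₁ = ∑[ i < n ] (w i * f i)
  S₂ = ∑[ i < n ] (w i * (f i * f i))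
  expand : ∀ w f W S → w * ((W * f - S) * (W * f - S)) ≡ W * W * (w * (f * f)) + - (+ 2 * W * S) * (w * f) + S * S * w
  expand = solve-∀
  collect : ∀ W S T → W * W * T + - (+ 2 * W * S) * S + S * S * W ≡ W * (W * T - S * S)
  collect = solve-∀

weighted-variance-zero : ∀ {n} (w f : Fin n → ℤ) → (∀ i → 0ℤ ≤ w i) →
  let W  = ∑[ i < n ] w i
      S₁ = ∑[ i < n ] (w i * f i)
      S₂ = ∑[ i < n ] (w i * (f i * f i))
  in W * S₂ ≡ S₁ * S₁ → ∀ i → w i ≢ 0ℤ → W * f i ≡ S₁
weighted-variance-zero {n} w f w≥0 WS₂≡S₁² i wᵢ≢0 =
  [ flip contradiction wᵢ≢0 , ℤ.i-j≡0⇒i≡j _ _ ∘ i*i≡0⇒i≡0 (d i) ]′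
    (ℤ.i*j≡0⇒i≡0∨j≡0 (w i) (∑-nonneg-≡0 0≤term ∑≡0 i))
  where
  d : Fin n → ℤ
  d j = ∑[ i < n ] w i * f j - ∑[ i < n ] (w i * f i)
  0≤term : ∀ j → 0ℤ ≤ w j * (d j * d j)
  0≤term j = 0≤i*j (w≥0 j) (0≤i*i (d j))
  ∑≡0 : ∑[ j < n ] (w j * (d j * d j)) ≡ 0ℤ
  ∑≡0 = trans (∑-weighted-variance w f)
              (trans (cong (∑[ i < n ] w i *_) (ℤ.i≡j⇒i-j≡0 WS₂≡S₁²)) (ℤ.*-zeroʳ (∑[ i < n ] w i)))

χ : ∀ {n} → Subset n → Fin n → ℤ
χ p i = 𝟙 (lookup p i)

χ-∈ : ∀ {n} {p : Subset n} {i} → i ∈ p → χ p i ≡ 1ℤ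
χ-∈ i∈p = cong 𝟙 ([]=⇒lookup i∈p)

χ-∉ : ∀ {n} {p : Subset n} {i} → i ∉ p → χ p i ≡ 0ℤ
χ-∉ {p = p} {i} i∉p with lookup p i in pᵢ
... | true  = contradiction (lookup⇒[]= i p pᵢ) i∉p
... | false = refl

χ-∩ : ∀ {n} (p q : Subset n) i → χ (p ∩ q) i ≡ χ p i * χ q i
χ-∩ p q i = trans (cong 𝟙 (lookup-zipWith _∧_ i p q)) (𝟙-∧ (lookup p i) (lookup q i))

∣p∣≡∑χ : ∀ {n} (p : Subset n) → + ∣ p ∣ ≡ ∑[ i < n ] χ p i
∣p∣≡∑χ []          = refl
∣p∣≡∑χ (true ∷ p)  = trans (ℤ.pos-+ 1 ∣ p ∣) (cong (_+_ 1ℤ) (∣p∣≡∑χ p))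
∣p∣≡∑χ (false ∷ p) = trans (∣p∣≡∑χ p) (sym (ℤ.+-identityˡ _))

∣p∣≡m⇒∑χ≡m : ∀ {n} (p : Subset n) {m} → ∣ p ∣ ≡ m → ∑[ i < n ] χ p i ≡ + m
∣p∣≡m⇒∑χ≡m p ∣p∣≡m = trans (sym (∣p∣≡∑χ p)) (cong +_ ∣p∣≡m)

∣p∩q∣≡∑χχ : ∀ {n} (p q : Subset n) → + ∣ p ∩ q ∣ ≡ ∑[ i < n ] (χ p i * χ q i)
∣p∩q∣≡∑χχ p q = trans (∣p∣≡∑χ (p ∩ q)) (sum-cong-≗ (χ-∩ p q))

χ-restrict : ∀ {n} {p : Subset n} {f g : Fin n → ℤ} → (∀ i → i ∈ p → f i ≡ g i) →
             ∀ i → χ p i * f i ≡ χ p i * g i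
χ-restrict {p = p} f≡g i with i ∈? p
... | yes i∈p = cong (χ p i *_) (f≡g i i∈p)
... | no  i∉p rewrite χ-∉ i∉p = refl

χᶜ-restrict : ∀ {n} {p : Subset n} {f g : Fin n → ℤ} → (∀ i → i ∉ p → f i ≡ g i) →
              ∀ i → (1ℤ - χ p i) * f i ≡ (1ℤ - χ p i) * g i
χᶜ-restrict {p = p} f≡g i with i ∈? p
... | yes i∈p rewrite χ-∈ i∈p = refl
... | no  i∉p = cong ((1ℤ - χ p i) *_) (f≡g i i∉p)

∑-χᶜ : ∀ {n} (p : Subset n) → ∑[ i < n ] (1ℤ - χ p i) ≡ + n - ∑[ i < n ] χ p i
∑-χᶜ {n} p = trans (∑-distrib-- (λ _ → 1ℤ) (χ p)) (cong (_- ∑[ i < n ] χ p i) (∑-1 n))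

∑-χᶜ-const : ∀ {n} {p : Subset n} {f : Fin n → ℤ} {a} → (∀ i → i ∉ p → f i ≡ a) →
             ∑[ i < n ] ((1ℤ - χ p i) * f i) ≡ (+ n - ∑[ i < n ] χ p i) * a
∑-χᶜ-const {n} {p} {a = a} f≡a =
  trans (sum-cong-≗ (χᶜ-restrict f≡a)) (trans (sym (*-distribʳ-sum a (λ i → 1ℤ - χ p i))) (cong (_* a) (∑-χᶜ p)))

∣⁅x⁆∪p∣≡1+∣p∣ : ∀ {n} {x : Fin n} (p : Subset n) → x ∉ p → ∣ ⁅ x ⁆ ∪ p ∣ ≡ suc ∣ p ∣
∣⁅x⁆∪p∣≡1+∣p∣ {x = zero}  (true ∷ p)  x∉p = contradiction here x∉p
∣⁅x⁆∪p∣≡1+∣p∣ {x = zero}  (false ∷ p) _   = cong (suc ∘ ∣_∣) (∪-identityˡ p)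
∣⁅x⁆∪p∣≡1+∣p∣ {x = suc x} (true ∷ p)  x∉p = cong suc (∣⁅x⁆∪p∣≡1+∣p∣ p (drop-not-there x∉p))
∣⁅x⁆∪p∣≡1+∣p∣ {x = suc x} (false ∷ p) x∉p = ∣⁅x⁆∪p∣≡1+∣p∣ p (drop-not-there x∉p)

0<∣p∣⇒nonempty : ∀ {n} (p : Subset n) → 0 ℕ.< ∣ p ∣ → Nonempty p
0<∣p∣⇒nonempty (true ∷ p)  _   = zero , here
0<∣p∣⇒nonempty (false ∷ p) 0<∣p∣ = map suc there (0<∣p∣⇒nonempty p 0<∣p∣)

module Quadratic (v k λ' : ℤ) where

  B D Cc : ℤ
  B = k * k - k + λ' - v * λ'
  D = v + λ' - (+ 2) * k
  Cc = k * (v - k - (+ 1))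

  q : ℤ → ℤ
  q t = D * t * t + B * t - Cc

  q-root : ∀ t → 0ℤ < D → ((+ 2) * D * t + B) * ((+ 2) * D * t + B) ≡ B * B + (+ 4) * Cc * D → q t ≡ 0ℤ
  q-root t 0<D disc =
    i*j≡0⇒j≡0 D {{>-nonZero 0<D}} (i*j≡0⇒j≡0 (+ 4) (trans (completeSquare D B Cc t) (ℤ.i≡j⇒i-j≡0 disc)))
    where
    completeSquare : ∀ D B C t → (+ 4) * (D * (D * t * t + B * t - C))
                                 ≡ ((+ 2) * D * t + B) * ((+ 2) * D * t + B) - (B * B + (+ 4) * C * D)
    completeSquare = solve-∀

  q-root-unique : ∀ s t → 0ℤ < D → 1ℤ ≤ Cc → q (+ s) ≡ 0ℤ → q (+ t) ≡ 0ℤ → s ≡ t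
  q-root-unique s t 0<D 1≤Cc qs≡0 qt≡0 =
    [ ℤ.+-injective ∘ ℤ.i-j≡0⇒i≡j (+ s) (+ t) , flip contradiction noSecondRoot ]′
      (ℤ.i*j≡0⇒i≡0∨j≡0 (+ s - + t) (trans (sym (factor D B Cc (+ s) (+ t))) (cong₂ _-_ qs≡0 qt≡0)))
    where
    factor : ∀ D B C s t → (D * s * s + B * s - C) - (D * t * t + B * t - C) ≡ (s - t) * (D * (s + t) + B)
    factor = solve-∀
    remainder : ∀ D B C s t → D * s * t + C ≡ t * (D * (s + t) + B) - (D * t * t + B * t - C)
    remainder = solve-∀
    1≰0 : ¬ (1ℤ ≤ 0ℤ)
    1≰0 (+≤+ ())
    noSecondRoot : D * (+ s + + t) + B ≢ 0ℤ
    noSecondRoot e = 1≰0 (subst (1ℤ ≤_) Dst+Cc≡0 (ℤ.+-mono-≤ 0≤Dst 1≤Cc))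
      where
      0≤Dst : 0ℤ ≤ D * + s * + t
      0≤Dst = 0≤i*j (0≤i*j (ℤ.<⇒≤ 0<D) (+≤+ ℕ.z≤n)) (+≤+ ℕ.z≤n)
      Dst+Cc≡0 : D * + s * + t + Cc ≡ 0ℤ
      Dst+Cc≡0 = trans (remainder D B Cc (+ s) (+ t))
                       (trans (cong₂ (λ a b → + t * a - b) e qt≡0) (cong (_- 0ℤ) (ℤ.*-zeroʳ (+ t))))

  -- Σ a and Σ a² over the vertices outside a clique of order c; see OutsideMoments.
  M₁ M₂ : ℤ → ℤ
  M₁ c = k * c - c * (c - 1ℤ)
  M₂ c = c * (k + (c - 1ℤ) * λ') - c * ((c - 1ℤ) * (c - 1ℤ))

  moment-identity : ∀ c → c * q (c - 1ℤ) ≡ M₁ c * M₁ c - (v - c) * M₂ c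
  moment-identity = identity v k λ'
    where
    identity : ∀ v k λ' c →
      c * ((v + λ' - (+ 2) * k) * (c - 1ℤ) * (c - 1ℤ) + (k * k - k + λ' - v * λ') * (c - 1ℤ) - k * (v - k - (+ 1)))
      ≡ (k * c - c * (c - 1ℤ)) * (k * c - c * (c - 1ℤ)) - (v - c) * (c * (k + (c - 1ℤ) * λ') - c * ((c - 1ℤ) * (c - 1ℤ)))
    identity = solve-∀

  M₁-suc : ∀ s → M₁ (+ suc s) ≡ + suc s * (k - + s)
  M₁-suc s = trans (cong M₁ (ℤ.pos-+ 1 s)) (trans (simplify k (+ s)) (cong (_* (k - + s)) (sym (ℤ.pos-+ 1 s))))
    where
    simplify : ∀ k s → k * (1ℤ + s) - (1ℤ + s) * (1ℤ + s - 1ℤ) ≡ (1ℤ + s) * (k - s)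
    simplify = solve-∀

module Counting {v : ℕ} (Γ : Graph v) where
  open Graph Γ using (adj; irrefl) renaming (sym to adj-sym)

  infix 4 _~_
  _~_ : Fin v → Fin v → Set
  _~_ = Defs._~_ Γ

  A : Fin v → Fin v → ℤ
  A x = χ (N Γ x)

  A≡𝟙adj : ∀ x y → A x y ≡ 𝟙 (adj x y)
  A≡𝟙adj x y = cong 𝟙 (lookup∘tabulate (adj x) y)

  A-~ : ∀ {x y} → x ~ y → A x y ≡ 1ℤ
  A-~ {x} {y} x~y = trans (A≡𝟙adj x y) (cong 𝟙 x~y)

  A-irrefl : ∀ x → A x x ≡ 0ℤ
  A-irrefl x = trans (A≡𝟙adj x x) (cong 𝟙 (irrefl x))

  A-sym : ∀ x y → A x y ≡ A y x
  A-sym x y = trans (A≡𝟙adj x y) (trans (cong 𝟙 (adj-sym x y)) (sym (A≡𝟙adj y x)))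

  HasNexus : Subset v → ℕ → Set
  HasNexus K m = ∀ u → u ∉ K → ∣ N Γ u ∩ K ∣ ≡ m

  nbrsIn : Subset v → Fin v → ℤ
  nbrsIn K u = ∑[ w < v ] (A u w * χ K w)

  ∣N∩K∣≡nbrsIn : ∀ K u → + ∣ N Γ u ∩ K ∣ ≡ nbrsIn K u
  ∣N∩K∣≡nbrsIn K u = ∣p∩q∣≡∑χχ (N Γ u) K

  common : Fin v → Fin v → ℤ
  common x y = ∑[ u < v ] (A x u * A y u)

  ∑A≡k : ∀ {k} → IsRegular Γ k → ∀ x → ∑[ u < v ] A x u ≡ + k
  ∑A≡k reg x = ∣p∣≡m⇒∑χ≡m (N Γ x) (reg x)

  common-refl : ∀ {k} → IsRegular Γ k → ∀ x → common x x ≡ + k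
  common-refl reg x = trans (sum-cong-≗ (λ u → 𝟙-idem (lookup (N Γ x) u))) (∑A≡k reg x)

  common-~ : ∀ {k λ'} → IsEdgeRegular Γ k λ' → ∀ {x y} → x ~ y → common x y ≡ + λ'
  common-~ (_ , er) {x} {y} x~y = trans (sym (∣p∩q∣≡∑χχ (N Γ x) (N Γ y))) (cong +_ (er x y x~y))

  ∑-nbrsIn : ∀ {k} → IsRegular Γ k → ∀ K → ∑[ u < v ] nbrsIn K u ≡ + k * ∑[ w < v ] χ K w
  ∑-nbrsIn {k} reg K = begin
    ∑[ u < v ] ∑[ w < v ] (A u w * χ K w)  ≡⟨ ∑-comm (λ u w → A u w * χ K w) ⟩
    ∑[ w < v ] ∑[ u < v ] (A u w * χ K w)  ≡⟨ sum-cong-≗ (λ w → sym (*-distribʳ-sum (χ K w) (λ u → A u w))) ⟩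
    ∑[ w < v ] (∑[ u < v ] A u w * χ K w)  ≡⟨ sum-cong-≗ (λ w → cong (_* χ K w) (∑A≡k′ w)) ⟩
    ∑[ w < v ] (+ k * χ K w)               ≡⟨ sym (*-distribˡ-sum (+ k) (χ K)) ⟩
    + k * ∑[ w < v ] χ K w                 ∎
    where
    open ≡-Reasoning
    ∑A≡k′ : ∀ w → ∑[ u < v ] A u w ≡ + k
    ∑A≡k′ w = trans (sum-cong-≗ (λ u → A-sym u w)) (∑A≡k reg w)

  ∑-nbrsIn² : ∀ K → ∑[ u < v ] (nbrsIn K u * nbrsIn K u)
                ≡ ∑[ w < v ] (χ K w * ∑[ w′ < v ] (χ K w′ * common w w′))
  ∑-nbrsIn² K = begin
    ∑[ u < v ] (nbrsIn K u * nbrsIn K u)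
      ≡⟨ sum-cong-≗ (λ u → ∑-*-∑ (λ w → A u w * χ K w) (λ w′ → A u w′ * χ K w′)) ⟩
    ∑[ u < v ] ∑[ w < v ] ∑[ w′ < v ] term u w w′
      ≡⟨ ∑-comm (λ u w → ∑[ w′ < v ] term u w w′) ⟩
    ∑[ w < v ] ∑[ u < v ] ∑[ w′ < v ] term u w w′
      ≡⟨ sum-cong-≗ (λ w → ∑-comm (λ u w′ → term u w w′)) ⟩
    ∑[ w < v ] ∑[ w′ < v ] ∑[ u < v ] term u w w′
      ≡⟨ sum-cong-≗ (λ w → sum-cong-≗ (λ w′ → pull-out w w′)) ⟩
    ∑[ w < v ] ∑[ w′ < v ] (χ K w * (χ K w′ * common w w′))
      ≡⟨ sum-cong-≗ (λ w → sym (*-distribˡ-sum (χ K w) (λ w′ → χ K w′ * common w w′))) ⟩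
    ∑[ w < v ] (χ K w * ∑[ w′ < v ] (χ K w′ * common w w′)) ∎
    where
    open ≡-Reasoning
    term : Fin v → Fin v → Fin v → ℤ
    term u w w′ = A u w * χ K w * (A u w′ * χ K w′)
    rearrange : ∀ a b c d → a * b * (c * d) ≡ b * (d * (a * c))
    rearrange = solve-∀
    pull-out : ∀ w w′ → ∑[ u < v ] term u w w′ ≡ χ K w * (χ K w′ * common w w′)
    pull-out w w′ = begin
      ∑[ u < v ] term u w w′
        ≡⟨ sum-cong-≗ (λ u → trans (rearrange (A u w) (χ K w) (A u w′) (χ K w′))
                                   (cong₂ (λ a b → χ K w * (χ K w′ * (a * b))) (A-sym u w) (A-sym u w′))) ⟩
      ∑[ u < v ] (χ K w * (χ K w′ * (A w u * A w′ u)))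
        ≡⟨ sym (*-distribˡ-sum (χ K w) (λ u → χ K w′ * (A w u * A w′ u))) ⟩
      χ K w * ∑[ u < v ] (χ K w′ * (A w u * A w′ u))
        ≡⟨ cong (χ K w *_) (sym (*-distribˡ-sum (χ K w′) (λ u → A w u * A w′ u))) ⟩
      χ K w * (χ K w′ * common w w′) ∎

  A*χ-clique : ∀ {K} → IsClique Γ K → ∀ {w} → w ∈ K → ∀ u → A w u * χ K u ≡ χ K u - δ w u
  A*χ-clique {K} cl {w} w∈K u with w ≟ u | u ∈? K
  ... | yes refl | _       rewrite A-irrefl w | χ-∈ w∈K = refl
  ... | no w≢u   | yes u∈K rewrite A-~ (cl w u w∈K u∈K w≢u) | χ-∈ u∈K = refl
  ... | no w≢u   | no u∉K  rewrite χ-∉ u∉K = ℤ.*-zeroʳ (A w u)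

  nbrsIn-clique : ∀ {K} → IsClique Γ K → ∀ {w} → w ∈ K → nbrsIn K w ≡ ∑[ u < v ] χ K u - 1ℤ
  nbrsIn-clique {K} cl {w} w∈K =
    trans (sum-cong-≗ (A*χ-clique cl w∈K)) (trans (∑-distrib-- (χ K) (δ w)) (cong (_-_ (∑[ u < v ] χ K u)) (∑δ≡1 w)))

  common-clique : ∀ {k λ'} → IsEdgeRegular Γ k λ' → ∀ {K} → IsClique Γ K → ∀ {w w′} → w ∈ K → w′ ∈ K →
                  common w w′ ≡ + λ' + (+ k - + λ') * δ w w′
  common-clique {k} {λ'} er cl {w} {w′} w∈K w′∈K with w ≟ w′
  ... | yes refl = trans (common-refl (proj₁ er) w) (sym (cancel (+ k) (+ λ')))
    where
    cancel : ∀ k l → l + (k - l) * 1ℤ ≡ k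
    cancel = solve-∀
  ... | no w≢w′ = trans (common-~ er (cl w w′ w∈K w′∈K w≢w′)) (sym (vanish (+ k) (+ λ')))
    where
    vanish : ∀ k l → l + (k - l) * 0ℤ ≡ l
    vanish = solve-∀

  ∑χ*common-clique : ∀ {k λ'} → IsEdgeRegular Γ k λ' → ∀ {K} → IsClique Γ K → ∀ {w} → w ∈ K →
                     ∑[ w′ < v ] (χ K w′ * common w w′) ≡ + k + (∑[ u < v ] χ K u - 1ℤ) * + λ'
  ∑χ*common-clique {k} {λ'} er {K} cl {w} w∈K = begin
    ∑[ w′ < v ] (χ K w′ * common w w′)
      ≡⟨ sum-cong-≗ (χ-restrict (λ w′ w′∈K → common-clique er cl w∈K w′∈K)) ⟩
    ∑[ w′ < v ] (χ K w′ * (+ λ' + (+ k - + λ') * δ w w′))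
      ≡⟨ sum-cong-≗ (λ w′ → spread (χ K w′) (+ λ') (+ k) (δ w w′)) ⟩
    ∑[ w′ < v ] (+ λ' * χ K w′ + (+ k - + λ') * (δ w w′ * χ K w′))
      ≡⟨ ∑-distrib-+ (λ w′ → + λ' * χ K w′) (λ w′ → (+ k - + λ') * (δ w w′ * χ K w′)) ⟩
    ∑[ w′ < v ] (+ λ' * χ K w′) + ∑[ w′ < v ] ((+ k - + λ') * (δ w w′ * χ K w′))
      ≡⟨ sym (cong₂ _+_ (*-distribˡ-sum (+ λ') (χ K)) (*-distribˡ-sum (+ k - + λ') (λ w′ → δ w w′ * χ K w′))) ⟩
    + λ' * c + (+ k - + λ') * ∑[ w′ < v ] (δ w w′ * χ K w′)
      ≡⟨ cong (λ x → + λ' * c + (+ k - + λ') * x) (trans (∑-δ w (χ K)) (χ-∈ w∈K)) ⟩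
    + λ' * c + (+ k - + λ') * 1ℤ
      ≡⟨ collect c (+ k) (+ λ') ⟩
    + k + (c - 1ℤ) * + λ' ∎
    where
    open ≡-Reasoning
    c : ℤ
    c = ∑[ u < v ] χ K u
    spread : ∀ x l k d → x * (l + (k - l) * d) ≡ l * x + (k - l) * (d * x)
    spread = solve-∀
    collect : ∀ c k l → l * c + (k - l) * 1ℤ ≡ k + (c - 1ℤ) * l
    collect = solve-∀

  ∑-nbrsIn²-clique : ∀ {k λ'} → IsEdgeRegular Γ k λ' → ∀ {K} → IsClique Γ K →
                   ∑[ u < v ] (nbrsIn K u * nbrsIn K u) ≡ ∑[ u < v ] χ K u * (+ k + (∑[ u < v ] χ K u - 1ℤ) * + λ')
  ∑-nbrsIn²-clique er {K} cl =
    trans (∑-nbrsIn² K)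
          (trans (sum-cong-≗ (χ-restrict (λ w w∈K → ∑χ*common-clique er cl w∈K)))
                 (sym (*-distribʳ-sum _ (χ K))))

  module OutsideMoments {k λ'} (er : IsEdgeRegular Γ k λ') {K} (cl : IsClique Γ K) where
    open Quadratic (+ v) (+ k) (+ λ')

    private
      c : ℤ
      c = ∑[ u < v ] χ K u

    ∑-outside-nbrsIn : ∑[ u < v ] ((1ℤ - χ K u) * nbrsIn K u) ≡ M₁ c
    ∑-outside-nbrsIn =
      trans (∑-complement (χ K) (nbrsIn K))
            (cong₂ _-_ (∑-nbrsIn (proj₁ er) K)
                       (trans (sum-cong-≗ (χ-restrict (λ u u∈K → nbrsIn-clique cl u∈K)))
                              (sym (*-distribʳ-sum (c - 1ℤ) (χ K)))))

    ∑-outside-nbrsIn² : ∑[ u < v ] ((1ℤ - χ K u) * (nbrsIn K u * nbrsIn K u)) ≡ M₂ c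
    ∑-outside-nbrsIn² =
      trans (∑-complement (χ K) (λ u → nbrsIn K u * nbrsIn K u))
            (cong₂ _-_ (∑-nbrsIn²-clique er cl)
                       (trans (sum-cong-≗ (χ-restrict (λ u u∈K → cong₂ _*_ (nbrsIn-clique cl u∈K)
                                                                            (nbrsIn-clique cl u∈K))))
                              (sym (*-distribʳ-sum ((c - 1ℤ) * (c - 1ℤ)) (χ K)))))

    root⇒nbrsIn-uniform : q (c - 1ℤ) ≡ 0ℤ → ∀ {u} → u ∉ K → (+ v - c) * nbrsIn K u ≡ M₁ c
    root⇒nbrsIn-uniform q≡0 {u} u∉K =
      subst₂ (λ W S₁ → W * nbrsIn K u ≡ S₁) (∑-χᶜ K) ∑-outside-nbrsIn
        (weighted-variance-zero w (nbrsIn K) (λ u → 0≤1-𝟙 (lookup K u)) W*S₂≡S₁*S₁ u wᵤ≢0)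
      where
      n*M₂≡M₁*M₁ : (+ v - c) * M₂ c ≡ M₁ c * M₁ c
      n*M₂≡M₁*M₁ =
        sym (ℤ.i-j≡0⇒i≡j _ _ (trans (sym (moment-identity c)) (trans (cong (c *_) q≡0) (ℤ.*-zeroʳ c))))
      w : Fin v → ℤ
      w u = 1ℤ - χ K u
      W*S₂≡S₁*S₁ : ∑[ u < v ] w u * ∑[ u < v ] (w u * (nbrsIn K u * nbrsIn K u))
                 ≡ ∑[ u < v ] (w u * nbrsIn K u) * ∑[ u < v ] (w u * nbrsIn K u)
      W*S₂≡S₁*S₁ = trans (cong₂ _*_ (∑-χᶜ K) ∑-outside-nbrsIn²)
                         (trans n*M₂≡M₁*M₁ (sym (cong₂ _*_ ∑-outside-nbrsIn ∑-outside-nbrsIn)))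
      wᵤ≢0 : w u ≢ 0ℤ
      wᵤ≢0 = subst (_≢ 0ℤ) (cong (_-_ 1ℤ) (sym (χ-∉ u∉K))) (λ ())

    regular-clique-moments : ∀ {m} → HasNexus K m →
                             M₁ c ≡ (+ v - c) * + m × M₂ c ≡ (+ v - c) * (+ m * + m)
    regular-clique-moments {m} nexus =
      trans (sym ∑-outside-nbrsIn) (∑-χᶜ-const nbrsIn≡m) ,
      trans (sym ∑-outside-nbrsIn²) (∑-χᶜ-const (λ u u∉K → cong₂ _*_ (nbrsIn≡m u u∉K) (nbrsIn≡m u u∉K)))
      where
      nbrsIn≡m : ∀ u → u ∉ K → nbrsIn K u ≡ + m
      nbrsIn≡m u u∉K = trans (sym (∣N∩K∣≡nbrsIn K u)) (cong +_ (nexus u u∉K))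

    regular-clique-root : ∀ {m} → HasNexus K m → c * q (c - 1ℤ) ≡ 0ℤ
    regular-clique-root {m} nexus = begin
      c * q (c - 1ℤ)
        ≡⟨ moment-identity c ⟩
      M₁ c * M₁ c - (+ v - c) * M₂ c
        ≡⟨ cong₂ (λ a b → a * a - (+ v - c) * b) (proj₁ moments) (proj₂ moments) ⟩
      (+ v - c) * + m * ((+ v - c) * + m) - (+ v - c) * ((+ v - c) * (+ m * + m))
        ≡⟨ square-cancels (+ v - c) (+ m) ⟩
      0ℤ ∎
      where
      open ≡-Reasoning
      moments : M₁ c ≡ (+ v - c) * + m × M₂ c ≡ (+ v - c) * (+ m * + m)
      moments = regular-clique-moments nexus
      square-cancels : ∀ n m → n * m * (n * m) - n * (n * (m * m)) ≡ 0ℤ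
      square-cancels = solve-∀

module Distance {v : ℕ} (Γ : Graph v) where
  open Graph Γ using (adj; irrefl) renaming (sym to adj-sym)
  open Counting Γ using (_~_; HasNexus)

  ~-sym : ∀ {x y} → x ~ y → y ~ x
  ~-sym {x} {y} x~y = trans (adj-sym y x) x~y

  ∈N⇒~ : ∀ {x y} → y ∈ N Γ x → x ~ y
  ∈N⇒~ {x} {y} y∈Nx = trans (sym (lookup∘tabulate (adj x) y)) ([]=⇒lookup y∈Nx)

  x∉Nx : ∀ x → x ∉ N Γ x
  x∉Nx x = (λ ()) ∘ trans (sym (irrefl x)) ∘ ∈N⇒~

  neighbour-in : ∀ {x K} → 0 ℕ.< ∣ N Γ x ∩ K ∣ → ∃[ w ] (w ∈ K × x ~ w)
  neighbour-in {x} {K} 0<∣N∩K∣ with 0<∣p∣⇒nonempty (N Γ x ∩ K) 0<∣N∩K∣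
  ... | w , w∈N∩K = w , proj₂ (x∈p∩q⁻ (N Γ x) K w∈N∩K) , ∈N⇒~ (proj₁ (x∈p∩q⁻ (N Γ x) K w∈N∩K))

  Far : Fin v → Fin v → Set
  Far x y = x ≢ y × ¬ x ~ y × (∀ z → ¬ (x ~ z × z ~ y))

  clique-neighbour⇒¬Far : ∀ {K x y w} → IsClique Γ K → x ∈ K → w ∈ K → y ~ w → ¬ Far x y
  clique-neighbour⇒¬Far {x = x} {w = w} cl x∈K w∈K y~w (_ , x≁y , no-common) with x ≟ w
  ... | yes refl = x≁y (~-sym y~w)
  ... | no x≢w   = no-common w (cl x w x∈K w∈K x≢w , ~-sym y~w)

  Far⇒∉regularClique : ∀ {C m x y} → IsClique Γ C → 1 ℕ.≤ m → HasNexus C m →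
                       Far x y → x ∉ C
  Far⇒∉regularClique {C} {x = x} {y} cl 1≤m nexus far@(x≢y , x≁y , _) x∈C with y ∈? C
  ... | yes y∈C = x≁y (cl x y x∈C y∈C x≢y)
  ... | no  y∉C with neighbour-in (subst (1 ℕ.≤_) (sym (nexus y y∉C)) 1≤m)
  ...   | w , w∈C , y~w = clique-neighbour⇒¬Far cl x∈C w∈C y~w far

  multipartite-neighbour⇒¬Far : ∀ {p x y z} → IsCompleteMultipartiteWithParts Γ p → x ~ z → ¬ Far x y
  multipartite-neighbour⇒¬Far {x = x} {y} {z} (part , _ , adjacency) x~z (_ , x≁y , no-common) =
    no-common z (x~z , proj₂ (adjacency z y) (λ pz≡py → proj₁ (adjacency x z) x~z (trans px≡py (sym pz≡py))))
    where
    px≡py : part x ≡ part y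
    px≡py = decidable-stable (part x ≟ part y) (λ px≢py → x≁y (proj₂ (adjacency x y) px≢py))

  nonadjacent⇒2+k≤v : ∀ {k x y} → IsRegular Γ k → x ≢ y → ¬ x ~ y → 2 ℕ.+ k ℕ.≤ v
  nonadjacent⇒2+k≤v {k} {x} {y} reg x≢y x≁y = subst (ℕ._≤ v) size (∣p∣≤n (⁅ y ⁆ ∪ ⁅ x ⁆ ∪ N Γ x))
    where
    y∉⁅x⁆∪Nx : y ∉ ⁅ x ⁆ ∪ N Γ x
    y∉⁅x⁆∪Nx y∈ = [ x≢y ∘ sym ∘ x∈⁅y⁆⇒x≡y x , x≁y ∘ ∈N⇒~ ]′ (x∈p∪q⁻ ⁅ x ⁆ (N Γ x) y∈)
    size : ∣ ⁅ y ⁆ ∪ ⁅ x ⁆ ∪ N Γ x ∣ ≡ 2 ℕ.+ k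
    size = trans (∣⁅x⁆∪p∣≡1+∣p∣ _ y∉⁅x⁆∪Nx)
                 (cong suc (trans (∣⁅x⁆∪p∣≡1+∣p∣ _ (x∉Nx x)) (cong suc (reg x))))

  cone : Fin v → Subset v → Subset v
  cone x C = ⁅ x ⁆ ∪ N Γ x ∩ C

  x∈cone : ∀ x C → x ∈ cone x C
  x∈cone x C = x∈p∪q⁺ (inj₁ (x∈⁅x⁆ x))

  ∣cone∣ : ∀ x C → ∣ cone x C ∣ ≡ suc ∣ N Γ x ∩ C ∣
  ∣cone∣ x C = ∣⁅x⁆∪p∣≡1+∣p∣ (N Γ x ∩ C) (x∉Nx x ∘ proj₁ ∘ x∈p∩q⁻ (N Γ x) C)

  ∈cone⁻ : ∀ {x C u} → u ∈ cone x C → u ≡ x ⊎ (x ~ u × u ∈ C)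
  ∈cone⁻ {x} {C} = [ inj₁ ∘ x∈⁅y⁆⇒x≡y x , inj₂ ∘ map₁ ∈N⇒~ ∘ x∈p∩q⁻ (N Γ x) C ]′ ∘ x∈p∪q⁻ ⁅ x ⁆ (N Γ x ∩ C)

  cone-clique : ∀ {C} → IsClique Γ C → ∀ x → IsClique Γ (cone x C)
  cone-clique cl x u w u∈ w∈ u≢w with ∈cone⁻ u∈ | ∈cone⁻ w∈
  ... | inj₁ refl        | inj₁ refl        = contradiction refl u≢w
  ... | inj₁ refl        | inj₂ (x~w , _)   = x~w
  ... | inj₂ (x~u , _)   | inj₁ refl        = ~-sym x~u
  ... | inj₂ (_ , u∈C)   | inj₂ (_ , w∈C)   = cl u w u∈C w∈C u≢w

  adjacent? : ∀ x y → Dec (x ~ y)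
  adjacent? x y = adj x y Bool.≟ true

  ¬Far⇒distance≤2 : ∀ {x y} → ¬ Far x y → x ≡ y ⊎ x ~ y ⊎ ∃[ z ] (x ~ z × z ~ y)
  ¬Far⇒distance≤2 {x} {y} ¬far with x ≟ y | adjacent? x y | any? (λ z → adjacent? x z ×-dec adjacent? z y)
  ... | yes x≡y | _       | _        = inj₁ x≡y
  ... | no _    | yes x~y | _        = inj₂ (inj₁ x~y)
  ... | no _    | no _    | yes path = inj₂ (inj₂ path)
  ... | no x≢y  | no x≁y  | no ¬path = contradiction (x≢y , x≁y , λ z path → ¬path (z , path)) ¬far

  ¬complete⇒nonadjacent : ¬ IsComplete Γ → ∃[ x ] ∃[ y ] (x ≢ y × ¬ x ~ y)
  ¬complete⇒nonadjacent ¬complete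
    with ¬∀⟶∃¬ v _ (λ x → all? (λ y → ¬? (x ≟ y) →-dec adjacent? x y)) ¬complete
  ... | x , ¬complete-at-x with ¬∀⟶∃¬ v _ (λ y → ¬? (x ≟ y) →-dec adjacent? x y) ¬complete-at-x
  ...   | y , ¬[x≢y⇒x~y] =
    x , y , (λ x≡y → ¬[x≢y⇒x~y] (contradiction x≡y)) , (λ x~y → ¬[x≢y⇒x~y] (λ _ → x~y))

module Neumaier {v : ℕ} (Γ : Graph v) {k λ' : ℕ} (er : IsEdgeRegular Γ k λ')
                {S E : ℕ} (paramE : IsParamE Γ k S E) where
  open Counting Γ
  open Distance Γ
  open Quadratic (+ v) (+ k) (+ λ')

  1≤Cc : 1 ℕ.≤ k → 2 ℕ.+ k ℕ.≤ v → 1ℤ ≤ Cc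
  1≤Cc 1≤k 2+k≤v = 1≤i*j (+≤+ 1≤k) (subst (1ℤ ≤_) shift (ℤ.+-monoˡ-≤ 1ℤ (ℤ.i≤j⇒0≤j-i (+≤+ 2+k≤v))))
    where
    shift : + v - + (2 ℕ.+ k) + 1ℤ ≡ + v - + k - + 1
    shift = trans (cong (λ t → + v - t + 1ℤ) (ℤ.pos-+ 2 k)) (rearrange (+ v) (+ k))
      where
      rearrange : ∀ v k → v - (+ 2 + k) + 1ℤ ≡ v - k - + 1
      rearrange = solve-∀

  CliquesExtend : Set
  CliquesExtend = (K : Subset v) → IsClique Γ K → ∣ K ∣ ≡ suc E →
                  Σ (Subset v) (λ D → IsClique Γ D × ∣ D ∣ ≡ suc S × K ⊆ D)

  module _ (0<D : 0ℤ < D) (qS≡0 : q (+ S) ≡ 0ℤ) where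

    average≡E : ∀ {a} → (+ v - + suc S) * + a ≡ M₁ (+ suc S) → a ≡ E
    average≡E {a} na≡M₁ = ℤ.+-injective (ℤ.*-cancelˡ-≡ (+ v - + suc S) (+ a) (+ E) {{≢-nonZero (proj₁ paramE)}}
      (trans na≡M₁ (trans (M₁-suc S) (trans (sym (proj₂ paramE)) (ℤ.*-comm (+ E) _)))))

    order-s+1-clique-nexus : ∀ {K} → IsClique Γ K → ∣ K ∣ ≡ suc S → HasNexus K E
    order-s+1-clique-nexus {K} cl ∣K∣≡1+S y y∉K =
      average≡E (subst (λ c → (+ v - c) * + ∣ N Γ y ∩ K ∣ ≡ M₁ c) ∑χ≡1+S
        (trans (cong ((+ v - ∑[ u < v ] χ K u) *_) (∣N∩K∣≡nbrsIn K y))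
               (root⇒nbrsIn-uniform (subst (λ c → q (c - 1ℤ) ≡ 0ℤ) (sym ∑χ≡1+S) qS≡0) y∉K)))
      where
      open OutsideMoments er cl
      ∑χ≡1+S : ∑[ u < v ] χ K u ≡ + suc S
      ∑χ≡1+S = ∣p∣≡m⇒∑χ≡m K ∣K∣≡1+S

    regular-clique-order : ∀ {K m} → 1ℤ ≤ Cc → IsClique Γ K → HasNexus K m →
                           0 ℕ.< ∣ K ∣ → ∣ K ∣ ≡ suc S
    regular-clique-order {K} 1≤Cc cl nexus 0<∣K∣ =
      trans (sym ∣K∣≡1+c) (cong suc (q-root-unique c S 0<D 1≤Cc qc≡0 qS≡0))
      where
      open OutsideMoments er cl
      c : ℕ
      c = ℕ.pred ∣ K ∣
      ∣K∣≡1+c : suc c ≡ ∣ K ∣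
      ∣K∣≡1+c = ℕ.suc-pred ∣ K ∣ {{ℕ.>-nonZero 0<∣K∣}}
      qc≡0 : q (+ c) ≡ 0ℤ
      qc≡0 = i*j≡0⇒j≡0 (+ suc c)
        (subst (λ c → c * q (c - 1ℤ) ≡ 0ℤ) (∣p∣≡m⇒∑χ≡m K (sym ∣K∣≡1+c)) (regular-clique-root nexus))

    regular-clique-nexus≡E : ∀ {K m} → IsClique Γ K → HasNexus K m → ∣ K ∣ ≡ suc S → m ≡ E
    regular-clique-nexus≡E {K} {m} cl nexus ∣K∣≡1+S =
      average≡E (sym (subst (λ c → M₁ c ≡ (+ v - c) * + m) (∣p∣≡m⇒∑χ≡m K ∣K∣≡1+S)
                            (proj₁ (regular-clique-moments nexus))))
      where
      open OutsideMoments er cl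

    nonMultipartite-¬Far : ∀ {C m} → IsClique Γ C → 1 ℕ.≤ m → HasNexus C m → CliquesExtend →
                           ∀ {x y} → ¬ Far x y
    nonMultipartite-¬Far {C} {m} Ccl 1≤m nexus extend {x} {y} far@(x≢y , x≁y , _) =
      conclude (extend (cone x C) (cone-clique Ccl x) (trans (∣cone∣ x C) (cong suc (trans ∣Nx∩C∣≡m m≡E))))
      where
      x∉C : x ∉ C
      x∉C = Far⇒∉regularClique Ccl 1≤m nexus far
      ∣Nx∩C∣≡m : ∣ N Γ x ∩ C ∣ ≡ m
      ∣Nx∩C∣≡m = nexus x x∉C
      1≤k : 1 ℕ.≤ k
      1≤k = ℕ.≤-trans 1≤m (subst₂ ℕ._≤_ ∣Nx∩C∣≡m (proj₁ er x) (∣p∩q∣≤∣p∣ (N Γ x) C))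
      0<∣C∣ : 0 ℕ.< ∣ C ∣
      0<∣C∣ = ℕ.≤-trans 1≤m (subst (ℕ._≤ ∣ C ∣) ∣Nx∩C∣≡m (∣p∩q∣≤∣q∣ (N Γ x) C))
      m≡E : m ≡ E
      m≡E = regular-clique-nexus≡E Ccl nexus
              (regular-clique-order (1≤Cc 1≤k (nonadjacent⇒2+k≤v (proj₁ er) x≢y x≁y)) Ccl nexus 0<∣C∣)
      conclude : Σ (Subset v) (λ D → IsClique Γ D × ∣ D ∣ ≡ suc S × cone x C ⊆ D) → ⊥
      conclude (D , Dcl , ∣D∣≡1+S , cone⊆D) =
        let w , w∈D , y~w = neighbour-in 0<∣Ny∩D∣ in clique-neighbour⇒¬Far Dcl x∈D w∈D y~w far
        where
        x∈D : x ∈ D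
        x∈D = cone⊆D (x∈cone x C)
        y∉D : y ∉ D
        y∉D y∈D = x≁y (Dcl x y x∈D y∈D x≢y)
        0<∣Ny∩D∣ : 0 ℕ.< ∣ N Γ y ∩ D ∣
        0<∣Ny∩D∣ = subst (1 ℕ.≤_) (sym (trans (order-s+1-clique-nexus Dcl ∣D∣≡1+S y y∉D) (sym m≡E))) 1≤m

  regular-clique⇒¬Far : IsParamS Γ k λ' S → CliquesExtend → ∀ {C m} → IsClique Γ C → 1 ℕ.≤ m →
                        HasNexus C m → ∀ {x y} → ¬ Far x y
  regular-clique⇒¬Far (inj₁ multipartite) _ Ccl 1≤m nexus {x} far =
    let _ , _ , x~w = neighbour-in (subst (1 ℕ.≤_) (sym (nexus x (Far⇒∉regularClique Ccl 1≤m nexus far))) 1≤m)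
    in multipartite-neighbour⇒¬Far multipartite x~w far
  regular-clique⇒¬Far (inj₂ (_ , 0<D , _ , disc)) extend Ccl 1≤m nexus far =
    nonMultipartite-¬Far 0<D (q-root (+ S) 0<D disc) Ccl 1≤m nexus extend far

lemma2p7 : (v k λ' S E : ℕ) (Γ : Graph v)
    → IsNeumaier Γ k λ'
    → IsParamS Γ k λ' S
    → IsParamE Γ k S E
    → ((C : Subset v) → IsClique Γ C → ∣ C ∣ ≡ suc E
         → Σ (Subset v) (λ D → IsClique Γ D × ∣ D ∣ ≡ suc S × C ⊆ D))
    → HasDiameter2 Γ
lemma2p7 v k λ' S E Γ (¬complete , er , C , Ccl , m , 1≤m , nexus) paramS paramE extend =
  (λ x y → ¬Far⇒distance≤2 (regular-clique⇒¬Far paramS extend Ccl 1≤m nexus)) , ¬complete⇒nonadjacent ¬complete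
  where
  open Distance Γ
  open Neumaier Γ er {S} {E} paramE
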